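{- Let $\mathcal{H}\subseteq E^{[\infty]}$ be a semicoideal. Then $\mathcal{H}$ is a coideal if and only if it satisfies A4 mod $\mathcal{H}$: for every $A\in\mathcal{H}$, every $a\in E^{[<\infty]}\restriction A$ and every set $\mathcal{O}$ of block sequences of length $\mathrm{lh}(a)+1$, there exists $B\in\mathcal{H}$ with $B\le A$ and $r_{d_A(a)}(B)=r_{d_A(a)}(A)$ such that $r_{\mathrm{lh}(a)+1}[a,B]\subseteq\mathcal{O}$ or $r_{\mathrm{lh}(a)+1}[a,B]\cap\mathcal{O}=\emptyset$.
   Context: $E$ is a vector space over a countable field $\mathbb{F}$ with countable Hamel basis $(e_n)_{n<\omega}$. For $x=\sum_n\lambda_ne_n$, $\mathrm{supp}(x)=\{n:\lambda_n\ne0\}$; for nonzero $x,y$, $x<y$ iff $\max\mathrm{supp}(x)<\min\mathrm{supp}(y)$. A block sequence is a $<$-increasing sequence of nonzero vectors; $E^{[\infty]}$ ($E^{[<\infty]}$) is the set of infinite (finite) ones; $\mathrm{lh}(a)$ is the length of $a\in E^{[<\infty]}$. For a block sequence $A=(x_n)$: $\langle A\rangle=\mathrm{span}\{x_n\}$, $r_n(A)=(x_i)_{i<n}$, $A/N=(x_n)_{n\ge N}$. $A\le B$ iff $\langle A\rangle\subseteq\langle B\rangle$; $A\le^*B$ iff $A/N\le B$ for some $N$. A semicoideal is a $\le^*$-upward closed $\mathcal{H}\subseteq E^{[\infty]}$; $\mathcal{H}\restriction A=\{B\in\mathcal{H}:B\le A\}$. $\mathcal{H}$ is a coideal if it is a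 semicoideal and for all $Y\subseteq E$ and $A\in\mathcal{H}$ there is $B\in\mathcal{H}\restriction A$ with $\langle B\rangle\subseteq Y$ or $\langle B\rangle\subseteq E\setminus Y$. $E^{[<\infty]}\restriction A$ is the set of $a\in E^{[<\infty]}$ with $\langle a\rangle\subseteq\langle A\rangle$. $d_A(a)$ is the least $N$ with $\max\mathrm{supp}(a)<\min\mathrm{supp}(y)$ for every term $y$ of $A/N$. $[a,B]=\{C\in E^{[\infty]}:C\le B,\ a=r_n(C)\text{ for some }n\}$, and $r_n[a,B]$ is the set of $b\in E^{[<\infty]}\restriction B$ of length $n$ having $a$ as an initial segment. -}

module Defs where

open import Level using (0ℓ)
open import Data.Nat using (ℕ; zero; suc; _<_; _≤_)
open import Data.Nat.Properties using ()
open import Data.Fin using (Fin; toℕ)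
import Data.Fin as Fin
open import Data.List using (List; []; _∷_; length; lookup)
open import Data.List.Relation.Unary.All using (All)
open import Data.List.Relation.Unary.Linked using (Linked)
open import Data.List.Relation.Binary.Pointwise using (Pointwise)
open import Data.List.Relation.Binary.Prefix.Heterogeneous using (Prefix)
open import Data.Product using (Σ; ∃; _×_; _,_; proj₁; proj₂)
open import Data.Sum using (_⊎_)
open import Relation.Nullary using (¬_)
open import Relation.Binary.PropositionalEquality using (_≡_)
open import Algebra.Bundles using (CommutativeRing)

record Field : Set₁ where
  field
    commRing : CommutativeRing 0ℓ 0ℓ
  open CommutativeRing commRing public hiding (ring)
  field
    0≉1 : ¬ (0# ≈ 1#)
    inverse : ∀ x → ¬ (x ≈ 0#) → Σ Carrier λ y → (x * y) ≈ 1#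

record CountableField : Set₁ where
  field
    fld : Field
  open Field fld public
  field
    code : Carrier → ℕ
    code-cong : ∀ {x y} → x ≈ y → code x ≡ code y
    code-inj  : ∀ {x y} → code x ≡ code y → x ≈ y

-- The space E with Hamel basis (e_n): vectors are identified with their
-- coordinate sequences (λ_n), which are finitely supported.

module Space (F : CountableField) where
  open CountableField F

  record V : Set where
    constructor vec
    field
      coef  : ℕ → Carrier
      bound : ℕ
      fin   : ∀ n → bound ≤ n → coef n ≈ 0#
  open V public

  _≈V_ : V → V → Set
  x ≈V y = ∀ n → coef x n ≈ coef y n

  _∈supp_ : ℕ → V → Set
  n ∈supp x = ¬ (coef x n ≈ 0#)

  NonZero : V → Set
  NonZero x = ∃ λ n → n ∈supp x

  _<V_ : V → V → Set
  x <V y = ∀ m n → m ∈supp x → n ∈supp y → m < n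

  0V : V
  0V = vec (λ _ → 0#) 0 (λ _ _ → refl)

  _+V_ : V → V → V
  vec f N p +V vec g M q =
    vec (λ n → f n + g n) (N Data.Nat.+ M)
      (λ n le → trans (+-cong (p n (lemL n le)) (q n (lemR n le))) (+-identityˡ 0#))
    where
      open import Data.Nat.Properties using (≤-trans; m≤m+n; m≤n+m)
      lemL : ∀ n → N Data.Nat.+ M ≤ n → N ≤ n
      lemL n le = ≤-trans (m≤m+n N M) le
      lemR : ∀ n → N Data.Nat.+ M ≤ n → M ≤ n
      lemR n le = ≤-trans (m≤n+m M N) le

  _·V_ : Carrier → V → V
  c ·V vec f N p = vec (λ n → c * f n) N
    (λ n le → trans (*-congˡ (p n le)) (zeroʳ c))

  lin : (gs : List V) → (Fin (length gs) → Carrier) → V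
  lin [] c = 0V
  lin (g ∷ gs) c = (c Fin.zero ·V g) +V lin gs (λ i → c (Fin.suc i))

  InSpan : List V → V → Set
  InSpan gs v = Σ (Fin (length gs) → Carrier) λ c → v ≈V lin gs c

  IsBlock : List V → Set
  IsBlock gs = All NonZero gs × Linked _<V_ gs

  FBS : Set
  FBS = Σ (List V) IsBlock

  lh : FBS → ℕ
  lh a = length (proj₁ a)

  IBS : Set
  IBS = Σ (ℕ → V) λ A → (∀ n → NonZero (A n)) × (∀ n → A n <V A (suc n))

  term : IBS → ℕ → V
  term A n = proj₁ A n

  r : ℕ → IBS → List V
  r zero A = []
  r (suc n) A = term A 0 ∷ r n (shift A)
    where
      shift : IBS → IBS
      shift (f , nz , bl) = (λ k → f (suc k)) , (λ k → nz (suc k)) , (λ k → bl (suc k))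

  tail : IBS → ℕ → IBS
  tail (f , nz , bl) N = (λ k → f (N Data.Nat.+ k)) , (λ k → nz (N Data.Nat.+ k)) ,
    (λ k → Relation.Binary.PropositionalEquality.subst
              (λ j → f (N Data.Nat.+ k) <V f j)
              (Relation.Binary.PropositionalEquality.sym
                 (Data.Nat.Properties.+-suc N k))
              (bl (N Data.Nat.+ k)))
    where import Data.Nat.Properties

  ⟨_⟩ : IBS → V → Set
  ⟨ A ⟩ v = ∃ λ n → InSpan (r n A) v

  ⟨_⟩f : FBS → V → Set
  ⟨ a ⟩f v = InSpan (proj₁ a) v

  _≤B_ : IBS → IBS → Set
  A ≤B B = ∀ v → ⟨ A ⟩ v → ⟨ B ⟩ v

  _≤*_ : IBS → IBS → Set
  A ≤* B = ∃ λ N → tail A N ≤B B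

  Semicoideal : (IBS → Set) → Set
  Semicoideal H = ∀ A B → H A → A ≤* B → H B

  RespectsV : (V → Set) → Set
  RespectsV Y = ∀ {x y} → x ≈V y → Y x → Y y

  -- coideals; ⟨B⟩ ⊆ Y is read on the nonzero vectors of ⟨B⟩
  Coideal : (IBS → Set) → Set₁
  Coideal H = Semicoideal H ×
    (∀ (Y : V → Set) → RespectsV Y → ∀ A → H A →
       Σ IBS λ B → H B × B ≤B A ×
         ((∀ v → ⟨ B ⟩ v → NonZero v → Y v) ⊎
          (∀ v → ⟨ B ⟩ v → NonZero v → ¬ Y v)))

  _∈fin↾_ : FBS → IBS → Set
  a ∈fin↾ A = ∀ v → ⟨ a ⟩f v → ⟨ A ⟩ v

  DBound : IBS → FBS → ℕ → Set
  DBound A a N = ∀ k → N ≤ k → All (λ x → ∀ m n → m ∈supp x → n ∈supp term A k → m < n) (proj₁ a)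

  IsD : IBS → FBS → ℕ → Set
  IsD A a N = DBound A a N × (∀ N' → N' < N → ¬ DBound A a N')

  InR[_,_,_] : ℕ → FBS → IBS → FBS → Set
  InR[ n , a , B ] b = b ∈fin↾ B × lh b ≡ n × Prefix _≈V_ (proj₁ a) (proj₁ b)

  RespectsF : (FBS → Set) → Set
  RespectsF O = ∀ {a b} → Pointwise _≈V_ (proj₁ a) (proj₁ b) → O a → O b

  A4mod : (IBS → Set) → Set₁
  A4mod H = ∀ A → H A → ∀ (a : FBS) → a ∈fin↾ A →
    ∀ (O : FBS → Set) → RespectsF O →
    ∀ d → IsD A a d →
    Σ IBS λ B → H B × B ≤B A × Pointwise _≈V_ (r d B) (r d A) ×
      ((∀ b → InR[ suc (lh a) , a , B ] b → O b) ⊎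
       (∀ b → InR[ suc (lh a) , a , B ] b → ¬ O b))

{-# OPTIONS --safe #-}
module Submission where

-- If H is a coideal, A ∈ H, a ∈ E^[<∞]↾A, d = d_A(a) and Y = {y : a⌢y ∈ O}, apply the coideal
-- property to Y below A/d to get C ∈ H, and let B = r_d(A)⌢C; then B ∈ H because B/d = C.
-- Every b ∈ r_{lh(a)+1}[a,B] is a′⌢y with a′ ≈ a, y ∈ ⟨B⟩ and y > a. Write y = Σ cᵢ Bᵢ: as the
-- terms of B have disjoint supports, cᵢ ≠ 0 forces supp Aᵢ ⊆ supp y for i < d, hence a < Aᵢ,
-- contradicting the minimality of d. So y ∈ ⟨C⟩, and r_{lh(a)+1}[a,B] lies in O or misses it
-- according to C. Conversely, A4 mod H for a = ∅ (so d = 0) and O = {(y) : y ∈ Y} is the coideal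
-- property. Equality in 𝔽 is decidable through its injection into ℕ, which makes the case
-- distinctions on coefficients constructive.

open import Defs
open import Data.Product using (_×_; Σ; ∃; _,_; proj₁; proj₂)
open import Data.Sum as Sum using (_⊎_; inj₁; inj₂)
open import Data.Empty using (⊥; ⊥-elim)
open import Data.Nat as ℕ using (ℕ; zero; suc; _∸_; _<_; _≤_; z≤n; s≤s)
open import Data.Nat.Properties
  using (suc-injective; <-cmp; <-irrefl; <-trans; <-≤-trans; ≮⇒≥; _<?_;
         m≤n⇒m<n∨m≡n; m<1+n⇒m<n∨m≡n; m≤m+n; m≤n+m)
open import Data.Fin as Fin using (toℕ)
open import Data.Fin.Properties using (toℕ<n; ¬∀⟶∃¬)
open import Data.List using (List; []; _∷_; length; _++_)
open import Data.List.Relation.Unary.All as All using (All; []; _∷_)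
open import Data.List.Relation.Unary.All.Properties using (++⁻ˡ; ++⁻ʳ)
open import Data.List.Relation.Unary.Linked using (Linked; []; [-]; _∷_)
open import Data.List.Relation.Binary.Pointwise as Pointwise using (Pointwise; []; _∷_)
open import Data.List.Relation.Binary.Prefix.Heterogeneous using (Prefix; []; _∷_)
open import Function using (_∘_)
open import Level using (0ℓ)
open import Relation.Binary.Bundles using (Setoid)
open import Relation.Binary.Definitions using (tri<; tri≈; tri>)
open import Relation.Binary.PropositionalEquality as ≡ using (_≡_; _≢_)
open import Relation.Nullary using (¬_; Dec; yes; no)
open import Relation.Nullary.Decidable using (map′; decidable-stable)

module _ (F : CountableField) where
  open CountableField F hiding (zero)
  open Space F
  open import Algebra.Properties.Semiring.Sum semiring
    using (sum; sum-cong-≋; sum-replicate-zero; ∑-distrib-+; *-distribˡ-sum)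
  open import Relation.Binary.Reasoning.Setoid setoid

  _≈?_ : ∀ x y → Dec (x ≈ y)
  x ≈? y = map′ code-inj code-cong (code x ℕ.≟ code y)

  x*y≉0 : ∀ {x y} → x ≉ 0# → y ≉ 0# → x * y ≉ 0#
  x*y≉0 {x} {y} x≉0 y≉0 xy≈0 with inverse x x≉0
  ... | x⁻¹ , xx⁻¹≈1 = y≉0 (begin
    y              ≈⟨ *-identityˡ y ⟨
    1# * y         ≈⟨ *-congʳ (trans (sym xx⁻¹≈1) (*-comm x x⁻¹)) ⟩
    (x⁻¹ * x) * y  ≈⟨ *-assoc x⁻¹ x y ⟩
    x⁻¹ * (x * y)  ≈⟨ *-congˡ xy≈0 ⟩
    x⁻¹ * 0#       ≈⟨ zeroʳ x⁻¹ ⟩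
    0#             ∎)

  x*y≉0⇒y≉0 : ∀ {x y} → x * y ≉ 0# → y ≉ 0#
  x*y≉0⇒y≉0 {x} xy≉0 y≈0 = xy≉0 (trans (*-congˡ y≈0) (zeroʳ x))

  -- Σ< (suc n) f reduces definitionally to f 0 + Σ< n (f ∘ suc).
  Σ< : ℕ → (ℕ → Carrier) → Carrier
  Σ< n f = sum {n} (f ∘ toℕ)

  Σ<-cong : ∀ n {f g} → (∀ i → i < n → f i ≈ g i) → Σ< n f ≈ Σ< n g
  Σ<-cong n f≈g = sum-cong-≋ (λ i → f≈g (toℕ i) (toℕ<n i))

  Σ<-zero : ∀ n {f} → (∀ i → i < n → f i ≈ 0#) → Σ< n f ≈ 0#
  Σ<-zero n f≈0 = trans (Σ<-cong n f≈0) (sum-replicate-zero n)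

  Σ<-≉0 : ∀ n {f} → Σ< n f ≉ 0# → ∃ λ i → i < n × f i ≉ 0#
  Σ<-≉0 n {f} Σ≉0 with ¬∀⟶∃¬ n (λ i → f (toℕ i) ≈ 0#) (λ i → f (toℕ i) ≈? 0#)
                         (λ f≈0 → Σ≉0 (trans (sum-cong-≋ f≈0) (sum-replicate-zero n)))
  ... | i , fᵢ≉0 = toℕ i , toℕ<n i , fᵢ≉0

  Σ<-single : ∀ n {f i} → i < n → (∀ j → j ≢ i → f j ≈ 0#) → Σ< n f ≈ f i
  Σ<-single (suc n) {f} {zero} _ off =
    trans (+-congˡ (Σ<-zero n {f ∘ suc} (λ j _ → off (suc j) (λ ())))) (+-identityʳ (f 0))
  Σ<-single (suc n) {f} {suc i} (s≤s i<n) off =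
    trans (+-congʳ (off 0 (λ ()))) (trans (+-identityˡ (Σ< n (f ∘ suc)))
      (Σ<-single n {f ∘ suc} i<n (λ j j≢i → off (suc j) (j≢i ∘ suc-injective))))

  Σ<-+ : ∀ n (f g : ℕ → Carrier) → Σ< n (λ i → f i + g i) ≈ Σ< n f + Σ< n g
  Σ<-+ n f g = ∑-distrib-+ {n} (f ∘ toℕ) (g ∘ toℕ)

  *-distribˡ-Σ< : ∀ n k (f : ℕ → Carrier) → k * Σ< n f ≈ Σ< n (λ i → k * f i)
  *-distribˡ-Σ< n k f = *-distribˡ-sum {n} k (f ∘ toℕ)

  truncate : ℕ → (ℕ → Carrier) → ℕ → Carrier
  truncate zero    c i       = 0#
  truncate (suc n) c zero    = c zero
  truncate (suc n) c (suc i) = truncate n (c ∘ suc) i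

  Σ<-truncate : ∀ {n m} (c x : ℕ → Carrier) → n ≤ m →
                Σ< m (λ i → truncate n c i * x i) ≈ Σ< n (λ i → c i * x i)
  Σ<-truncate {zero}  {m}     c x _         = Σ<-zero m (λ i _ → zeroˡ (x i))
  Σ<-truncate {suc n} {suc m} c x (s≤s n≤m) = +-congˡ (Σ<-truncate (c ∘ suc) (x ∘ suc) n≤m)

  -- Membership in a span is stated for coordinate functions rather than vectors,
  -- so that linear combinations need no finite-support proof.
  record Span (Y : ℕ → V) (w : ℕ → Carrier) : Set where
    constructor span
    field
      size      : ℕ
      coeff     : ℕ → Carrier
      expansion : ∀ q → w q ≈ Σ< size (λ i → coeff i * coef (Y i) q)

  Span-resp : ∀ {Y w w′} → (∀ q → w q ≈ w′ q) → Span Y w → Span Y w′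
  Span-resp w≈w′ (span n c w≈) = span n c λ q → trans (sym (w≈w′ q)) (w≈ q)

  Span-0 : ∀ {Y} → Span Y (λ _ → 0#)
  Span-0 = span 0 (λ _ → 0#) λ _ → refl

  δ : ℕ → ℕ → Carrier
  δ zero    zero    = 1#
  δ zero    (suc i) = 0#
  δ (suc k) zero    = 0#
  δ (suc k) (suc i) = δ k i

  Span-term : ∀ Y k → Span Y (coef (Y k))
  Span-term Y k = span (suc k) (δ k) (unit k Y)
    where
      unit : ∀ k (Y : ℕ → V) q → coef (Y k) q ≈ Σ< (suc k) (λ i → δ k i * coef (Y i) q)
      unit zero    Y q = sym (trans (+-identityʳ _) (*-identityˡ _))
      unit (suc k) Y q =
        trans (unit k (Y ∘ suc) q) (sym (trans (+-congʳ (zeroˡ _)) (+-identityˡ _)))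

  Span-+ : ∀ {Y w₁ w₂} → Span Y w₁ → Span Y w₂ → Span Y (λ q → w₁ q + w₂ q)
  Span-+ {Y} {w₁} {w₂} (span n₁ c₁ w₁≈) (span n₂ c₂ w₂≈) = span n (λ i → t₁ i + t₂ i) λ q →
    begin
      w₁ q + w₂ q
        ≈⟨ +-cong (w₁≈ q) (w₂≈ q) ⟩
      Σ< n₁ (c₁ ⊙ Y[ q ]) + Σ< n₂ (c₂ ⊙ Y[ q ])
        ≈⟨ +-cong (Σ<-truncate c₁ Y[ q ] (m≤m+n n₁ n₂)) (Σ<-truncate c₂ Y[ q ] (m≤n+m n₂ n₁)) ⟨
      Σ< n (t₁ ⊙ Y[ q ]) + Σ< n (t₂ ⊙ Y[ q ])
        ≈⟨ Σ<-+ n (t₁ ⊙ Y[ q ]) (t₂ ⊙ Y[ q ]) ⟨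
      Σ< n (λ i → t₁ i * Y[ q ] i + t₂ i * Y[ q ] i)
        ≈⟨ Σ<-cong n (λ i _ → distribʳ (Y[ q ] i) (t₁ i) (t₂ i)) ⟨
      Σ< n (λ i → (t₁ i + t₂ i) * Y[ q ] i)
    ∎
    where
      n : ℕ
      n = n₁ ℕ.+ n₂
      t₁ t₂ : ℕ → Carrier
      t₁ = truncate n₁ c₁
      t₂ = truncate n₂ c₂
      Y[_] : ℕ → ℕ → Carrier
      Y[ q ] i = coef (Y i) q
      _⊙_ : (ℕ → Carrier) → (ℕ → Carrier) → ℕ → Carrier
      (f ⊙ g) i = f i * g i

  Span-* : ∀ {Y w} k → Span Y w → Span Y (λ q → k * w q)
  Span-* {Y} k (span n c w≈) = span n (λ i → k * c i) λ q →
    trans (*-congˡ (w≈ q)) (trans (*-distribˡ-Σ< n k (λ i → c i * coef (Y i) q))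
      (Σ<-cong n (λ i _ → sym (*-assoc k (c i) (coef (Y i) q)))))

  Span-Σ< : ∀ {Y} n (w : ℕ → ℕ → Carrier) → (∀ i → i < n → Span Y (w i)) →
            Span Y (λ q → Σ< n (λ i → w i q))
  Span-Σ< zero    w _  = Span-0
  Span-Σ< (suc n) w w∈ =
    Span-+ {w₁ = w 0} (w∈ 0 (s≤s z≤n)) (Span-Σ< n (w ∘ suc) (λ i i<n → w∈ (suc i) (s≤s i<n)))

  Span-trans : ∀ {Y} X {w} → (∀ i → Span Y (coef (X i))) → Span X w → Span Y w
  Span-trans X X⊆Y (span n c w≈) =
    Span-resp (λ q → sym (w≈ q))
      (Span-Σ< n (λ i q → c i * coef (X i) q) (λ i _ → Span-* (c i) (X⊆Y i)))

  -- Agrees definitionally with the shift local to the definition of r.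
  shift : IBS → IBS
  shift (f , nz , bl) = f ∘ suc , nz ∘ suc , bl ∘ suc

  r-All : ∀ {P : V → Set} n (X : IBS) → (∀ i → P (term X i)) → All P (r n X)
  r-All zero    X P-terms = []
  r-All (suc n) X P-terms = P-terms 0 ∷ r-All n (shift X) (P-terms ∘ suc)

  r-cong : ∀ n (X Y : IBS) → (∀ i → i < n → term X i ≡ term Y i) → r n X ≡ r n Y
  r-cong zero    X Y X≡Y = ≡.refl
  r-cong (suc n) X Y X≡Y =
    ≡.cong₂ _∷_ (X≡Y 0 (s≤s z≤n)) (r-cong n (shift X) (shift Y) (λ i i<n → X≡Y (suc i) (s≤s i<n)))

  lin∈Span : ∀ {Y} gs c → All (λ g → Span Y (coef g)) gs → Span Y (coef (lin gs c))
  lin∈Span []       c []         = Span-0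
  lin∈Span (g ∷ gs) c (g∈ ∷ gs∈) = Span-+ (Span-* (c Fin.zero) g∈) (lin∈Span gs (c ∘ Fin.suc) gs∈)

  lin-r : ∀ n X (c : ℕ → Carrier) q →
          coef (lin (r n X) (c ∘ toℕ)) q ≈ Σ< n (λ i → c i * coef (term X i) q)
  lin-r zero    X c q = refl
  lin-r (suc n) X c q = +-congˡ (lin-r n (shift X) (c ∘ suc) q)

  ⟨⟩⇒Span : ∀ {X v} → ⟨ X ⟩ v → Span (term X) (coef v)
  ⟨⟩⇒Span {X} (n , c , v≈) =
    Span-resp (λ q → sym (v≈ q)) (lin∈Span (r n X) c (r-All n X (Span-term (term X))))

  Span⇒⟨⟩ : ∀ {X v} → Span (term X) (coef v) → ⟨ X ⟩ v
  Span⇒⟨⟩ {X} (span n c v≈) = n , c ∘ toℕ , λ q → trans (v≈ q) (sym (lin-r n X c q))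

  InSpan⇒⟨⟩ : ∀ {X gs v} → All ⟨ X ⟩ gs → InSpan gs v → ⟨ X ⟩ v
  InSpan⇒⟨⟩ {X} {gs} {v} gs⊆X (c , v≈) =
    Span⇒⟨⟩ {X} {v}
      (Span-resp (λ q → sym (v≈ q)) (lin∈Span gs c (All.map (λ {g} → ⟨⟩⇒Span {X} {g}) gs⊆X)))

  term∈⟨⟩ : ∀ X k → ⟨ X ⟩ (term X k)
  term∈⟨⟩ X k = Span⇒⟨⟩ {X} {term X k} (Span-term (term X) k)

  terms⇒≤B : ∀ {X Y} → (∀ k → ⟨ Y ⟩ (term X k)) → X ≤B Y
  terms⇒≤B {X} {Y} X⊆Y v v∈X =
    Span⇒⟨⟩ {Y} {v}
      (Span-trans (term X) (λ k → ⟨⟩⇒Span {Y} {term X k} (X⊆Y k)) (⟨⟩⇒Span {X} {v} v∈X))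

  tail-≤ : ∀ X d → tail X d ≤B X
  tail-≤ X d = terms⇒≤B {tail X d} {X} (λ k → term∈⟨⟩ X (d ℕ.+ k))

  supp-⟨⟩ : ∀ {X v q} → ⟨ X ⟩ v → q ∈supp v → ∃ λ j → q ∈supp term X j
  supp-⟨⟩ {X} {v} {q} v∈X q∈v with ⟨⟩⇒Span {X} {v} v∈X
  ... | span n c v≈
    with Σ<-≉0 n {λ j → c j * coef (term X j) q} (λ Σ≈0 → q∈v (trans (v≈ q) Σ≈0))
  ... | j , _ , cⱼXⱼ≉0 = j , x*y≉0⇒y≉0 {c j} cⱼXⱼ≉0

  term-nonzero : ∀ (X : IBS) i → NonZero (term X i)
  term-nonzero X = proj₁ (proj₂ X)

  term-<V-suc : ∀ (X : IBS) i → term X i <V term X (suc i)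
  term-<V-suc X = proj₂ (proj₂ X)

  <V-trans : ∀ {x y z} → NonZero y → x <V y → y <V z → x <V z
  <V-trans (p , p∈y) x<y y<z m n m∈x n∈z = <-trans (x<y m p m∈x p∈y) (y<z p n p∈y n∈z)

  term-<V : ∀ (X : IBS) {i j} → i < j → term X i <V term X j
  term-<V X {i} {suc j} i<1+j with m<1+n⇒m<n∨m≡n i<1+j
  ... | inj₁ i<j    = <V-trans {term X i} {term X j} {term X (suc j)}
                        (term-nonzero X j) (term-<V X i<j) (term-<V-suc X j)
  ... | inj₂ ≡.refl = term-<V-suc X i

  supp-injective : ∀ (X : IBS) {i j q} → q ∈supp term X i → q ∈supp term X j → i ≡ j
  supp-injective X {i} {j} {q} q∈Xᵢ q∈Xⱼ with <-cmp i j
  ... | tri< i<j _ _ = ⊥-elim (<-irrefl ≡.refl (term-<V X i<j q q q∈Xᵢ q∈Xⱼ))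
  ... | tri≈ _ i≡j _ = i≡j
  ... | tri> _ _ j<i = ⊥-elim (<-irrefl ≡.refl (term-<V X j<i q q q∈Xⱼ q∈Xᵢ))

  expansion-on-supp : ∀ (X : IBS) {w} (s : Span (term X) w) {i q} → i < Span.size s →
                      q ∈supp term X i → w q ≈ Span.coeff s i * coef (term X i) q
  expansion-on-supp X (span n c w≈) {i} {q} i<n q∈Xᵢ =
    trans (w≈ q) (Σ<-single n {λ j → c j * coef (term X j) q} i<n off)
    where
      off : ∀ j → j ≢ i → c j * coef (term X j) q ≈ 0#
      off j j≢i = trans (*-congˡ (decidable-stable (coef (term X j) q ≈? 0#)
                                   (λ q∈Xⱼ → j≢i (supp-injective X q∈Xⱼ q∈Xᵢ))))
                        (zeroʳ (c j))

  term-supp⊆ : ∀ (X : IBS) {y} (s : Span (term X) (coef y)) {i} → i < Span.size s →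
               Span.coeff s i ≉ 0# → ∀ q → q ∈supp term X i → q ∈supp y
  term-supp⊆ X s i<n cᵢ≉0 q q∈Xᵢ y≈0 =
    x*y≉0 cᵢ≉0 q∈Xᵢ (trans (sym (expansion-on-supp X s i<n q∈Xᵢ)) y≈0)

  <V-supp-⊆ : ∀ {x y z} → (∀ q → q ∈supp z → q ∈supp y) → x <V y → x <V z
  <V-supp-⊆ z⊆y x<y m q m∈x q∈z = x<y m q m∈x (z⊆y q q∈z)

  below⇒DBound : ∀ (A : IBS) (a : FBS) i → All (_<V term A i) (proj₁ a) → DBound A a i
  below⇒DBound A a i a<Aᵢ k i≤k with m≤n⇒m<n∨m≡n i≤k
  ... | inj₁ i<k    = All.map (λ {x} x<Aᵢ → <V-trans {x} {term A i} {term A k}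
                                                (term-nonzero A i) x<Aᵢ (term-<V A i<k)) a<Aᵢ
  ... | inj₂ ≡.refl = a<Aᵢ

  stitch : ℕ → (ℕ → V) → (ℕ → V) → ℕ → V
  stitch zero    f g i       = g i
  stitch (suc d) f g zero    = f zero
  stitch (suc d) f g (suc i) = stitch d (f ∘ suc) g i

  stitch-< : ∀ d f g {i} → i < d → stitch d f g i ≡ f i
  stitch-< (suc d) f g {zero}  _         = ≡.refl
  stitch-< (suc d) f g {suc i} (s≤s i<d) = stitch-< d (f ∘ suc) g i<d

  stitch-+ : ∀ d f g k → stitch d f g (d ℕ.+ k) ≡ g k
  stitch-+ zero    f g k = ≡.refl
  stitch-+ (suc d) f g k = stitch-+ d (f ∘ suc) g k

  stitch-≥ : ∀ d f g {i} → d ≤ i → stitch d f g i ≡ g (i ∸ d)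
  stitch-≥ zero    f g _                 = ≡.refl
  stitch-≥ (suc d) f g {suc i} (s≤s d≤i) = stitch-≥ d (f ∘ suc) g d≤i

  stitch-All : ∀ {P : V → Set} d {f g} → (∀ i → P (f i)) → (∀ k → P (g k)) →
               ∀ i → P (stitch d f g i)
  stitch-All     zero    Pf Pg i       = Pg i
  stitch-All     (suc d) Pf Pg zero    = Pf zero
  stitch-All {P} (suc d) Pf Pg (suc i) = stitch-All {P} d (Pf ∘ suc) Pg i

  stitch-<V-suc : ∀ d {f g} → (∀ i → f i <V f (suc i)) → (∀ k → g k <V g (suc k)) →
                  (∀ i → i < d → f i <V g 0) → ∀ i → stitch d f g i <V stitch d f g (suc i)
  stitch-<V-suc zero          _  g< _   i       = g< i
  stitch-<V-suc (suc zero)    _  _  f<g zero    = f<g 0 (s≤s z≤n)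
  stitch-<V-suc (suc (suc d)) f< _  _   zero    = f< 0
  stitch-<V-suc (suc d) {f}   f< g< f<g (suc i) =
    stitch-<V-suc d {f ∘ suc} (f< ∘ suc) g< (λ j j<d → f<g (suc j) (s≤s j<d)) i

  ≤tail⇒below : ∀ (A C : IBS) d → C ≤B tail A d → ∀ i → i < d → term A i <V term C 0
  ≤tail⇒below A C d C≤A/d i i<d m q m∈Aᵢ q∈C₀ =
    below (supp-⟨⟩ {tail A d} {term C 0} C₀∈A/d q∈C₀)
    where
      C₀∈A/d : ⟨ tail A d ⟩ (term C 0)
      C₀∈A/d = C≤A/d (term C 0) (term∈⟨⟩ C 0)
      below : (∃ λ j → q ∈supp term (tail A d) j) → m < q
      below (j , q∈Aᵈ⁺ʲ) = term-<V A (<-≤-trans i<d (m≤m+n d j)) m q m∈Aᵢ q∈Aᵈ⁺ʲ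

  V-setoid : Setoid 0ℓ 0ℓ
  V-setoid = record
    { Carrier       = V
    ; _≈_           = _≈V_
    ; isEquivalence = record
      { refl  = λ _ → refl
      ; sym   = λ x≈y n → sym (x≈y n)
      ; trans = λ x≈y y≈z n → trans (x≈y n) (y≈z n)
      }
    }

  open import Data.List.Relation.Binary.Equality.Setoid V-setoid using (≋-refl; ≋-sym; ≋-trans)

  <V-respˡ-All : ∀ {xs xs′ y} → Pointwise _≈V_ xs xs′ → All (_<V y) xs′ → All (_<V y) xs
  <V-respˡ-All []                        []              = []
  <V-respˡ-All {y = y} (x≈x′ ∷ xs≈xs′) (x′<y ∷ xs′<y) =
    (λ m n m∈x → x′<y m n (λ x′ₘ≈0 → m∈x (trans (x≈x′ m) x′ₘ≈0)))
    ∷ <V-respˡ-All {y = y} xs≈xs′ xs′<y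

  prefix-snoc : ∀ {as bs} → Prefix _≈V_ as bs → length bs ≡ suc (length as) →
                ∃ λ y → ∃ λ as′ → bs ≡ as′ ++ y ∷ [] × Pointwise _≈V_ as as′
  prefix-snoc {bs = y ∷ []} [] _ = y , [] , ≡.refl , []
  prefix-snoc {bs = _ ∷ _ ∷ _} [] ()
  prefix-snoc (a≈b ∷ pre) len with prefix-snoc pre (suc-injective len)
  ... | y , as′ , ≡.refl , as≈as′ = y , _ ∷ as′ , ≡.refl , a≈b ∷ as≈as′

  linked-last : ∀ xs {y} → All NonZero xs → Linked _<V_ (xs ++ y ∷ []) → All (_<V y) xs
  linked-last []                _               _            = []
  linked-last (x ∷ [])          _               (x<y ∷ [-])  = x<y ∷ []
  linked-last (x ∷ x′ ∷ xs) {y} (_ ∷ nz′ ∷ nzs) (x<x′ ∷ lnk)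
    with linked-last (x′ ∷ xs) (nz′ ∷ nzs) lnk
  ... | x′<y ∷ xs<y = <V-trans {x} {x′} {y} nz′ x<x′ x′<y ∷ x′<y ∷ xs<y

  InSpan-last : ∀ xs y → InSpan (xs ++ y ∷ []) y
  InSpan-last []       y = (λ _ → 1#) , λ n → sym (trans (+-identityʳ _) (*-identityˡ _))
  InSpan-last (x ∷ xs) y with InSpan-last xs y
  ... | c , y≈ = (λ { Fin.zero → 0# ; (Fin.suc i) → c i }) ,
                 λ n → trans (y≈ n) (sym (trans (+-congʳ (zeroˡ _)) (+-identityˡ _)))

  InR-snoc : ∀ {a X} b → InR[ suc (lh a) , a , X ] b →
             ∃ λ y → NonZero y × ⟨ X ⟩ y × All (_<V y) (proj₁ a) ×
                     Pointwise _≈V_ (proj₁ b) (proj₁ a ++ y ∷ [])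
  InR-snoc (bs , nz , lnk) (b↾X , len , pre) with prefix-snoc pre len
  ... | y , as′ , ≡.refl , a≈as′ =
    y , All.head (++⁻ʳ as′ nz) , b↾X y (InSpan-last as′ y) ,
    <V-respˡ-All {y = y} a≈as′ (linked-last as′ (++⁻ˡ as′ nz) lnk) ,
    Pointwise.++⁺ (≋-sym a≈as′) ≋-refl

  -- The set {y : a⌢y ∈ O}; a⌢y is compared up to ≈ since O only sees block sequences.
  Successors : (FBS → Set) → FBS → V → Set
  Successors O a y = ∃ λ b → O b × Pointwise _≈V_ (proj₁ b) (proj₁ a ++ y ∷ [])

  Successors-resp : ∀ O a → RespectsV (Successors O a)
  Successors-resp O a y≈y′ (b , Ob , b≈ay) =
    b , Ob , ≋-trans b≈ay (Pointwise.++⁺ ≋-refl (y≈y′ ∷ []))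

  module Stitched (A C : IBS) (d : ℕ) (C≤A/d : C ≤B tail A d) where

    B : IBS
    B = stitch d (term A) (term C)
      , stitch-All {NonZero} d (term-nonzero A) (term-nonzero C)
      , stitch-<V-suc d (term-<V-suc A) (term-<V-suc C) (≤tail⇒below A C d C≤A/d)

    r-B≈r-A : Pointwise _≈V_ (r d B) (r d A)
    r-B≈r-A = ≡.subst (Pointwise _≈V_ (r d B)) (r-cong d B A (λ i → stitch-< d (term A) (term C)))
                ≋-refl

    B≤A : B ≤B A
    B≤A = terms⇒≤B {B} {A} (stitch-All {⟨ A ⟩} d (term∈⟨⟩ A) C⊆A)
      where
        C⊆A : ∀ k → ⟨ A ⟩ (term C k)
        C⊆A k = tail-≤ A d (term C k) (C≤A/d (term C k) (term∈⟨⟩ C k))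

    C≤*B : C ≤* B
    C≤*B = 0 , terms⇒≤B {tail C 0} {B}
                 (λ k → ≡.subst ⟨ B ⟩ (stitch-+ d (term A) (term C) k) (term∈⟨⟩ B (d ℕ.+ k)))

    above⇒∈⟨C⟩ : (a : FBS) → (∀ i → i < d → ¬ DBound A a i) →
                 ∀ {y} → ⟨ B ⟩ y → All (_<V y) (proj₁ a) → ⟨ C ⟩ y
    above⇒∈⟨C⟩ a d-min {y} y∈B a<y =
      Span⇒⟨⟩ {C} {y} (Span-resp (λ q → sym (expansion q)) (Span-Σ< size summand summand∈))
      where
        s : Span (term B) (coef y)
        s = ⟨⟩⇒Span {B} {y} y∈B
        open Span s

        summand : ℕ → ℕ → Carrier
        summand i q = coeff i * coef (term B i) q

        Aᵢ⊆y : ∀ {i} → i < size → i < d → coeff i ≉ 0# → ∀ q → q ∈supp term A i → q ∈supp y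
        Aᵢ⊆y i<n i<d cᵢ≉0 q q∈Aᵢ =
          term-supp⊆ B {y} s i<n cᵢ≉0 q
            (≡.subst (q ∈supp_) (≡.sym (stitch-< d (term A) (term C) i<d)) q∈Aᵢ)

        vanishes : ∀ {i} → i < size → i < d → coeff i ≈ 0#
        vanishes {i} i<n i<d = decidable-stable (coeff i ≈? 0#) λ cᵢ≉0 →
          d-min i i<d (below⇒DBound A a i
            (All.map (λ {x} → <V-supp-⊆ {x} {y} {term A i} (Aᵢ⊆y i<n i<d cᵢ≉0)) a<y))

        summand∈ : ∀ i → i < size → Span (term C) (summand i)
        summand∈ i i<n = by-position (i <? d)
          where
            by-position : Dec (i < d) → Span (term C) (summand i)
            by-position (yes i<d) =
              Span-resp (λ q → trans (sym (zeroˡ _)) (*-congʳ (sym (vanishes i<n i<d)))) Span-0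
            by-position (no i≮d) =
              ≡.subst (λ v → Span (term C) (λ q → coeff i * coef v q))
                (≡.sym (stitch-≥ d (term A) (term C) (≮⇒≥ i≮d)))
                (Span-* (coeff i) (Span-term (term C) (i ∸ d)))

    transfer : (a : FBS) → (∀ i → i < d → ¬ DBound A a i) → ∀ O → RespectsF O →
               (∀ v → ⟨ C ⟩ v → NonZero v → Successors O a v) ⊎
               (∀ v → ⟨ C ⟩ v → NonZero v → ¬ Successors O a v) →
               (∀ b → InR[ suc (lh a) , a , B ] b → O b) ⊎
               (∀ b → InR[ suc (lh a) , a , B ] b → ¬ O b)
    transfer a d-min O O-resp (inj₁ all) = inj₁ λ b b∈ →
      let y , nz , y∈B , a<y , b≈ay = InR-snoc {a} {B} b b∈
          b′ , Ob′ , b′≈ay = all y (above⇒∈⟨C⟩ a d-min {y} y∈B a<y) nz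
      in O-resp (≋-trans b′≈ay (≋-sym b≈ay)) Ob′
    transfer a d-min O O-resp (inj₂ none) = inj₂ λ b b∈ Ob →
      let y , nz , y∈B , a<y , b≈ay = InR-snoc {a} {B} b b∈
      in none y (above⇒∈⟨C⟩ a d-min {y} y∈B a<y) nz (b , Ob , b≈ay)

  coideal⇒A4mod : (H : IBS → Set) → Semicoideal H → Coideal H → A4mod H
  coideal⇒A4mod H semi (_ , coideal) A HA a _ O O-resp d (_ , d-min) =
    let C , HC , C≤A/d , homogeneous =
          coideal (Successors O a) (Successors-resp O a) (tail A d)
                  (semi A (tail A d) HA (d , λ _ v∈ → v∈))
        open Stitched A C d C≤A/d
    in B , semi C B HC C≤*B , B≤A , r-B≈r-A , transfer a d-min O O-resp homogeneous

  OnSingletons : (V → Set) → List V → Set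
  OnSingletons Y (y ∷ []) = Y y
  OnSingletons Y _        = ⊥

  OnSingletons-resp : ∀ Y → RespectsV Y → RespectsF (OnSingletons Y ∘ proj₁)
  OnSingletons-resp Y Y-resp (y≈y′ ∷ []) = Y-resp y≈y′

  ∅ : FBS
  ∅ = [] , [] , []

  singleton∈r₁ : ∀ {X v} → ⟨ X ⟩ v → (nz : NonZero v) →
                 InR[ 1 , ∅ , X ] (v ∷ [] , nz ∷ [] , [-])
  singleton∈r₁ {X} {v} v∈X _ = (λ w → InSpan⇒⟨⟩ {X} {v ∷ []} {w} (v∈X ∷ [])) , ≡.refl , []

  A4mod⇒coideal : (H : IBS → Set) → Semicoideal H → A4mod H → Coideal H
  A4mod⇒coideal H semi A4 = semi , homogeneous
    where
      homogeneous : ∀ Y → RespectsV Y → ∀ A → H A →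
                    Σ IBS λ B → H B × B ≤B A ×
                      ((∀ v → ⟨ B ⟩ v → NonZero v → Y v) ⊎ (∀ v → ⟨ B ⟩ v → NonZero v → ¬ Y v))
      homogeneous Y Y-resp A HA =
        let B , HB , B≤A , _ , decided =
              A4 A HA ∅ (λ _ v∈ → 0 , v∈) (OnSingletons Y ∘ proj₁)
                 (λ {b} {b′} → OnSingletons-resp Y Y-resp {b} {b′}) 0 ((λ _ _ → []) , λ _ ())
        in B , HB , B≤A ,
           Sum.map (λ all  v v∈B nz → all  (v ∷ [] , nz ∷ [] , [-]) (singleton∈r₁ {B} {v} v∈B nz))
                   (λ none v v∈B nz → none (v ∷ [] , nz ∷ [] , [-]) (singleton∈r₁ {B} {v} v∈B nz))
                   decided

lemma7p2 : (F : CountableField) → let open Space F in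
    (H : IBS → Set) → Semicoideal H → (Coideal H → A4mod H) × (A4mod H → Coideal H)
lemma7p2 F H semi = coideal⇒A4mod F H semi , A4mod⇒coideal F H semi
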